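{- Let $\lambda$ be a monadic stream GSOS specification over a signature $\Sigma$ and output set $A$, let $\mathcal V$ be a set of variables, and let $m_\lambda$ be the Mealy machine on open terms $T\mathcal V$ defined below, with output $o_t(\varsigma)$ and derivative $d_t(\varsigma)$ of $t$ on input $\varsigma$. For every substitution $\theta:\mathcal V\to T\mathcal V$ and every input $\varsigma:\mathcal V\to A$ there exist a substitution $\theta':\mathcal V\to T\mathcal V$ and an input $\varsigma':\mathcal V\to A$ such that for all terms $t\in T\mathcal V$: $o_{\theta(t)}(\varsigma)=o_t(\varsigma')$ and $d_{\theta(t)}(\varsigma)=\theta'(d_t(\varsigma'))$.
   Context: A signature $\Sigma$ is a set of operation symbols with finite arities; $T\mathcal V$ is the set of $\Sigma$-terms over variables $\mathcal V$. A substitution $\theta:\mathcal V\to T\mathcal V$ extends to $T\mathcal V\to T\mathcal V$ by replacing each variable $\mathcal X$ with $\theta(\mathcal X)$. A monadic stream GSOS specification for $\Sigma$ and $A$ is a set of rules $\frac{x_1\xrightarrow{a_1}x_1'\cdots x_n\xrightarrow{a_n}x_n'}{f(x_1,\dots,x_n)\xrightarrow{a}t}$ ($f$ of arity $n$, pairwise distinct variables, $t$ a $\Sigma$-term over $\{x_1',\dots,x_n'\}$ only) such that for each $f$ and each $(a_1,\dots,a_n)\in A^n$ exactly one rule for $f$ has premise labels $(a_1,\dots,a_n)$. The Mealy machine $m_\lambda:T\mathcal V\to(A\times T\mathcal V)^{A^{\mathcal V}}$, $m_\lambda(t)(\varsigma)=(o_t(\varsigma),d_t(\varsigma))$, written $t\xrightarrow{\varsigma\mid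 o_t(\varsigma)}d_t(\varsigma)$, is defined inductively: for a variable $\mathcal X$, $\mathcal X\xrightarrow{\varsigma\mid\varsigma(\mathcal X)}\mathcal X$; and $f(t_1,\dots,t_n)\xrightarrow{\varsigma\mid a}t[t_1'/x_1',\dots,t_n'/x_n']$ whenever $t_i\xrightarrow{\varsigma\mid a_i}t_i'$ for all $i$ and the rule for $f$ with premise labels $(a_1,\dots,a_n)$ has conclusion $f(\vec x)\xrightarrow{a}t$. -}

module Defs where

open import Data.Nat using (ℕ)
open import Data.Fin using (Fin)
open import Data.Vec using (Vec; []; _∷_; lookup)
open import Data.Product using (_×_; _,_; proj₁; proj₂)

record Signature : Set₁ where
  field
    Op : Set
    ar : Op → ℕ
open Signature public

data Term (Σ : Signature) (V : Set) : Set where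
  var : V → Term Σ V
  op  : (f : Op Σ) → Vec (Term Σ V) (ar Σ f) → Term Σ V

module _ {Σ : Signature} {V W : Set} (θ : V → Term Σ W) where
  mutual
    subst : Term Σ V → Term Σ W
    subst (var x)   = θ x
    subst (op f ts) = op f (substs ts)

    substs : ∀ {n} → Vec (Term Σ V) n → Vec (Term Σ W) n
    substs []       = []
    substs (t ∷ ts) = subst t ∷ substs ts

-- The requirement that for
-- each f and each premise labelling (a₁,…,aₙ) ∈ Aⁿ there is exactly one rule
-- is encoded by a function assigning to f and (a₁,…,aₙ) the conclusion of
-- that unique rule: its label a and its target term t over {x₁',…,xₙ'}
-- (the variable xᵢ' being represented by i : Fin n).
MonadicGSOS : Signature → Set → Set
MonadicGSOS Σ A = (f : Op Σ) → Vec A (ar Σ f) → A × Term Σ (Fin (ar Σ f))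

module _ {Σ : Signature} {A : Set} (λ' : MonadicGSOS Σ A) {V : Set} where
  mutual
    mealy : Term Σ V → (V → A) → A × Term Σ V
    mealy (var X)   ς = ς X , var X
    mealy (op f ts) ς with mealys ts ς
    ... | as , ts' with λ' f as
    ...   | a , t = a , subst (lookup ts') t

    mealys : ∀ {n} → Vec (Term Σ V) n → (V → A) → Vec A n × Vec (Term Σ V) n
    mealys []       ς = [] , []
    mealys (t ∷ ts) ς with mealy t ς | mealys ts ς
    ... | a , t' | as , ts' = a ∷ as , t' ∷ ts'

  out : Term Σ V → (V → A) → A
  out t ς = proj₁ (mealy t ς)

  der : Term Σ V → (V → A) → Term Σ V
  der t ς = proj₂ (mealy t ς)

-- Substituting θ into t and running on ς is the same as running t on the
-- input ς' X = o_{θ X}(ς) and then substituting the derivatives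
-- θ' X = d_{θ X}(ς): a variable X of t behaves exactly like the term θ X,
-- and a rule fired on the instantiated arguments targets the instantiation
-- of its conclusion, which is the substitution lemma for terms.
module Submission where

open import Defs
open import Data.Product using (Σ-syntax; _×_; _,_; proj₁; proj₂; map₂; zip)
open import Data.Vec using (Vec; []; _∷_; lookup)
open import Data.Fin using (Fin; zero; suc)
open import Relation.Binary.PropositionalEquality
  using (_≡_; refl; cong; cong₂; sym; module ≡-Reasoning)

module _ {Sig : Signature} where

  mutual
    subst-cong : ∀ {V W} {θ ψ : V → Term Sig W} → (∀ x → θ x ≡ ψ x) →
                 (t : Term Sig V) → subst θ t ≡ subst ψ t
    subst-cong θ≗ψ (var x)   = θ≗ψ x
    subst-cong θ≗ψ (op f ts) = cong (op f) (substs-cong θ≗ψ ts)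

    substs-cong : ∀ {V W n} {θ ψ : V → Term Sig W} → (∀ x → θ x ≡ ψ x) →
                  (ts : Vec (Term Sig V) n) → substs θ ts ≡ substs ψ ts
    substs-cong θ≗ψ []       = refl
    substs-cong θ≗ψ (t ∷ ts) = cong₂ _∷_ (subst-cong θ≗ψ t) (substs-cong θ≗ψ ts)

  mutual
    subst-subst : ∀ {U V W} (θ : V → Term Sig W) (ψ : U → Term Sig V) (t : Term Sig U) →
                  subst θ (subst ψ t) ≡ subst (λ x → subst θ (ψ x)) t
    subst-subst θ ψ (var x)   = refl
    subst-subst θ ψ (op f ts) = cong (op f) (substs-substs θ ψ ts)

    substs-substs : ∀ {U V W n} (θ : V → Term Sig W) (ψ : U → Term Sig V)
                    (ts : Vec (Term Sig U) n) →
                    substs θ (substs ψ ts) ≡ substs (λ x → subst θ (ψ x)) ts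
    substs-substs θ ψ []       = refl
    substs-substs θ ψ (t ∷ ts) = cong₂ _∷_ (subst-subst θ ψ t) (substs-substs θ ψ ts)

  lookup-substs : ∀ {V W n} (θ : V → Term Sig W) (ts : Vec (Term Sig V) n) (i : Fin n) →
                  lookup (substs θ ts) i ≡ subst θ (lookup ts i)
  lookup-substs θ (t ∷ ts) zero    = refl
  lookup-substs θ (t ∷ ts) (suc i) = lookup-substs θ ts i

  subst-lookup-substs : ∀ {V W n} (θ : V → Term Sig W) (ts : Vec (Term Sig V) n)
                        (u : Term Sig (Fin n)) →
                        subst (lookup (substs θ ts)) u ≡ subst θ (subst (lookup ts) u)
  subst-lookup-substs θ ts u = begin
    subst (lookup (substs θ ts)) u          ≡⟨ subst-cong (lookup-substs θ ts) u ⟩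
    subst (λ i → subst θ (lookup ts i)) u   ≡⟨ sym (subst-subst θ (lookup ts) u) ⟩
    subst θ (subst (lookup ts) u)           ∎
    where open ≡-Reasoning

module _ {Sig : Signature} {A : Set} (λ' : MonadicGSOS Sig A) where

  fire : ∀ {V} (f : Op Sig) → Vec A (ar Sig f) × Vec (Term Sig V) (ar Sig f) → A × Term Sig V
  fire f (as , ts') = map₂ (subst (lookup ts')) (λ' f as)

  fire-substs : ∀ {V W} (θ : V → Term Sig W) (f : Op Sig)
                (p : Vec A (ar Sig f) × Vec (Term Sig V) (ar Sig f)) →
                fire f (map₂ (substs θ) p) ≡ map₂ (subst θ) (fire f p)
  fire-substs θ f (as , ts') =
    cong (proj₁ (λ' f as) ,_) (subst-lookup-substs θ ts' (proj₂ (λ' f as)))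

  module _ {V W : Set} (θ : V → Term Sig W) (ς : W → A) where

    substInput : V → A
    substInput X = out λ' (θ X) ς

    substDerivative : V → Term Sig W
    substDerivative X = der λ' (θ X) ς

    mutual
      mealy-subst : (t : Term Sig V) →
                    mealy λ' (subst θ t) ς ≡ map₂ (subst substDerivative) (mealy λ' t substInput)
      mealy-subst (var X)   = refl
      -- mealy λ' (op f ts) ρ unfolds definitionally to fire f (mealys λ' ts ρ).
      mealy-subst (op f ts) = begin
        fire f (mealys λ' (substs θ ts) ς)
          ≡⟨ cong (fire f) (mealys-substs ts) ⟩
        fire f (map₂ (substs substDerivative) (mealys λ' ts substInput))
          ≡⟨ fire-substs substDerivative f (mealys λ' ts substInput) ⟩
        map₂ (subst substDerivative) (fire f (mealys λ' ts substInput))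
          ∎
        where open ≡-Reasoning

      mealys-substs : ∀ {n} (ts : Vec (Term Sig V) n) →
                      mealys λ' (substs θ ts) ς ≡ map₂ (substs substDerivative) (mealys λ' ts substInput)
      mealys-substs []       = refl
      mealys-substs (t ∷ ts) = cong₂ (zip _∷_ _∷_) (mealy-subst t) (mealys-substs ts)

lemma2 : (Sig : Signature) (A : Set) (λ' : MonadicGSOS Sig A) (V : Set)
         (θ : V → Term Sig V) (ς : V → A) →
         Σ[ θ' ∈ (V → Term Sig V) ] Σ[ ς' ∈ (V → A) ]
           ((t : Term Sig V) →
             (out λ' (subst θ t) ς ≡ out λ' t ς')
             × (der λ' (subst θ t) ς ≡ subst θ' (der λ' t ς')))
lemma2 Sig A λ' V θ ς =
  substDerivative λ' θ ς , substInput λ' θ ς ,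
  λ t → cong proj₁ (mealy-subst λ' θ ς t) , cong proj₂ (mealy-subst λ' θ ς t)
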